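{- At any time during the execution of $\mathrm{DASH}$ on an initial graph with $n$ nodes, for every vertex $v$, $\mathrm{rem}(v)\le n$.
   Context: Setting: algorithm $\mathrm{DASH}$ for self-healing against adversarial node deletions, starting from a connected graph $G_0$ on $n$ nodes. After a deletion of $x$, edges are added only among former neighbours of $x$. $E_h$ is the set of healing edges added so far, and $G_h=(V,E_h)$ on the current node set $V$. This graph is a forest. $N(v,G_h)$ is the set of neighbours of $v$ in $G_h$. Weights: each vertex $v$ has weight $w(v)$, initially $1$. When $v$ is deleted, $w(v)$ is added to the weight of an arbitrarily chosen neighbour of $v$ in $G_h$. $W(S)$ is the total weight of the vertices of a subgraph $S$. $T(x,y)$ is the tree of $G_h-y$ containing $x$. Define $\mathrm{rem}(v)=\sum_{u\in N(v,G_h)}W(T(u,v))-\max_{u\in N(v,G_h)}W(T(u,v))+w(v)$. -}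

module Defs where

open import Data.Nat using (ℕ; zero; suc; _+_; _∸_; _⊔_; _≤_)
open import Data.Fin using (Fin; zero; suc)
open import Data.Bool using (Bool; true; false; if_then_else_)
open import Data.List using (List; []; _∷_)
open import Data.List.Relation.Unary.Unique.Propositional using (Unique)
open import Data.List.Relation.Unary.Linked using (Linked)
open import Data.Product using (Σ; ∃; _×_; _,_)
open import Data.Sum using (_⊎_)
open import Data.Unit using (⊤)
open import Relation.Nullary using (¬_)
open import Relation.Binary.PropositionalEquality using (_≡_; _≢_)
open import Relation.Binary.Construct.Closure.ReflexiveTransitive using (Star)
open import Function.Bundles using (_⇔_)

Σᶠ : (n : ℕ) → (Fin n → ℕ) → ℕ
Σᶠ zero    f = 0
Σᶠ (suc n) f = f zero + Σᶠ n (λ i → f (suc i))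

Maxᶠ : (n : ℕ) → (Fin n → ℕ) → ℕ
Maxᶠ zero    f = 0
Maxᶠ (suc n) f = f zero ⊔ Maxᶠ n (λ i → f (suc i))

Graph : ℕ → Set
Graph n = Fin n → Fin n → Bool

Symmetric : ∀ {n} → Graph n → Set
Symmetric E = ∀ a b → E a b ≡ E b a

Irreflexive : ∀ {n} → Graph n → Set
Irreflexive E = ∀ a → E a a ≡ false

-- Walks in E from a to c all of whose vertices after the first satisfy P.
data Walk {n : ℕ} (E : Graph n) (P : Fin n → Set) : Fin n → Fin n → Set where
  here  : ∀ {a} → Walk E P a a
  there : ∀ {a b c} → E a b ≡ true → P b → Walk E P b c → Walk E P a c

Connected : ∀ {n} → Graph n → Set
Connected E = ∀ a b → Walk E (λ _ → ⊤) a b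

Adj : ∀ {n} → Graph n → Fin n → Fin n → Set
Adj E a b = E a b ≡ true

-- A cycle: at least three distinct vertices v₀ … vₖ, consecutive ones adjacent,
-- and vₖ adjacent to v₀.
last : ∀ {A : Set} → A → List A → A
last a []       = a
last a (b ∷ bs) = last b bs

Cycle : ∀ {n} → Graph n → Set
Cycle {n} E = Σ (Fin n) λ a → Σ (Fin n) λ b → Σ (Fin n) λ c → Σ (List (Fin n)) λ rest →
  Unique (a ∷ b ∷ c ∷ rest) × Linked (Adj E) (a ∷ b ∷ c ∷ rest) × Adj E (last c rest) a

Forest : ∀ {n} → Graph n → Set
Forest E = ¬ Cycle E

record State (n : ℕ) : Set where
  field
    alive : Fin n → Bool
    G     : Graph n
    H     : Graph n
    w     : Fin n → ℕ
open State public

initial : ∀ {n} → Graph n → State n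
initial G₀ = record { alive = λ _ → true ; G = G₀ ; H = λ _ _ → false ; w = λ _ → 1 }

-- One round: the adversary deletes an alive node x; healing edges (set N) are added
-- only among former neighbours of x in G; G_h stays a forest; w(x) is given to an
-- arbitrarily chosen neighbour of x in G_h (if x has one).
Step : ∀ {n} → State n → State n → Set
Step {n} s s' = Σ (Fin n) λ x → Σ (Graph n) λ N →
    (alive s x ≡ true)
  × (∀ y → (alive s' y ≡ true) ⇔ ((alive s y ≡ true) × y ≢ x))
  × Symmetric N
  × (∀ a b → N a b ≡ true → (G s x a ≡ true) × (G s x b ≡ true) × a ≢ b)
  × (∀ a b → (G s' a b ≡ true) ⇔ (((G s a b ≡ true) × a ≢ x × b ≢ x) ⊎ N a b ≡ true))
  × (∀ a b → (H s' a b ≡ true) ⇔ (((H s a b ≡ true) × a ≢ x × b ≢ x) ⊎ N a b ≡ true))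
  × Forest (H s')
  × ( (Σ (Fin n) λ u → (H s x u ≡ true) × (w s' u ≡ w s u + w s x)
                       × (∀ y → y ≢ u → y ≢ x → w s' y ≡ w s y))
    ⊎ ((∀ u → H s x u ≡ false) × (∀ y → y ≢ x → w s' y ≡ w s y)) )

Reachable : ∀ {n} → Graph n → State n → Set
Reachable G₀ s = Star Step (initial G₀) s

-- T(u,v) membership: z is in the tree of G_h - v containing u
InT : ∀ {n} → State n → (u v z : Fin n) → Set
InT s u v z = Walk (H s) (λ y → (alive s y ≡ true) × y ≢ v) u z

-- W(T(u,v)), given the characteristic function T u of T(u,v)
WT : ∀ {n} → State n → (Fin n → Bool) → ℕ
WT {n} s Tu = Σᶠ n (λ z → if Tu z then w s z else 0)

rem : ∀ {n} → State n → (T : Fin n → Fin n → Bool) → Fin n → ℕ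
rem {n} s T v =
  (Σᶠ n (λ u → if H s v u then WT s (T u) else 0)
    ∸ Maxᶠ n (λ u → if H s v u then WT s (T u) else 0))
  + w s v

-- Weight only ever moves from a deleted vertex to a living neighbour, so the total
-- weight of the living vertices never exceeds its initial value n. The trees T(u,v)
-- for the G_h-neighbours u of v avoid v and are pairwise disjoint, since a vertex
-- common to two of them would close a cycle through v in the forest G_h. Hence
-- Σ_u W(T(u,v)) + w(v) is at most the living weight, and rem(v) is smaller still.
module Submission where

open import Defs
open import Data.Nat using (ℕ; zero; suc; _+_; _≤_; z≤n)
open import Data.Fin using (Fin; zero; suc)
open import Data.Bool using (Bool; true; false; if_then_else_)
open import Relation.Binary.PropositionalEquality
  using (_≡_; _≢_; ≢-sym; refl; sym; trans; cong; cong₂; subst)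
open import Function.Bundles using (_⇔_; module Equivalence)
open import Data.Empty using (⊥-elim)
open import Data.Fin.Properties using (_≟_; suc-injective)
open import Data.List using (List; []; _∷_)
open import Data.List.Membership.Propositional using (_∈_)
open import Data.List.Relation.Unary.All using (All; []; _∷_)
open import Data.List.Relation.Unary.All.Properties using (¬Any⇒All¬)
open import Data.List.Relation.Unary.AllPairs using ([]; _∷_)
open import Data.List.Relation.Unary.Any using (here; there)
open import Data.List.Relation.Unary.Linked using (Linked; []; [-]; _∷_)
open import Data.List.Relation.Unary.Unique.Propositional using (Unique)
open import Data.Nat.Properties
  using (+-commutativeSemigroup; +-mono-≤; +-monoˡ-≤; +-cancelʳ-≤; +-identityʳ; +-comm;
         m∸n≤m; ≤-refl; ≤-reflexive; ≤-trans; module ≤-Reasoning)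
  renaming (_≟_ to _≟ℕ_)
open import Algebra.Properties.CommutativeSemigroup +-commutativeSemigroup using (interchange)
open import Data.Product using (_×_; _,_; proj₁; proj₂)
open import Data.Sum using (inj₁; inj₂; [_,_]′)
open import Relation.Binary.Construct.Closure.ReflexiveTransitive using (Star; ε; _◅_)
open import Relation.Nullary using (yes; no; does)

open Equivalence using (to; from)

Σᶠ-cong : ∀ n {f g : Fin n → ℕ} → (∀ i → f i ≡ g i) → Σᶠ n f ≡ Σᶠ n g
Σᶠ-cong zero    f≡g = refl
Σᶠ-cong (suc n) f≡g = cong₂ _+_ (f≡g zero) (Σᶠ-cong n (λ i → f≡g (suc i)))

Σᶠ-mono-≤ : ∀ n {f g : Fin n → ℕ} → (∀ i → f i ≤ g i) → Σᶠ n f ≤ Σᶠ n g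
Σᶠ-mono-≤ zero    f≤g = z≤n
Σᶠ-mono-≤ (suc n) f≤g = +-mono-≤ (f≤g zero) (Σᶠ-mono-≤ n (λ i → f≤g (suc i)))

Σᶠ-zero : ∀ n {f : Fin n → ℕ} → (∀ i → f i ≡ 0) → Σᶠ n f ≡ 0
Σᶠ-zero zero    f≡0 = refl
Σᶠ-zero (suc n) f≡0 = cong₂ _+_ (f≡0 zero) (Σᶠ-zero n (λ i → f≡0 (suc i)))

Σᶠ-const-1 : ∀ n → Σᶠ n (λ _ → 1) ≡ n
Σᶠ-const-1 zero    = refl
Σᶠ-const-1 (suc n) = cong suc (Σᶠ-const-1 n)

Σᶠ-distrib-+ : ∀ n (f g : Fin n → ℕ) → Σᶠ n (λ i → f i + g i) ≡ Σᶠ n f + Σᶠ n g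
Σᶠ-distrib-+ zero    f g = refl
Σᶠ-distrib-+ (suc n) f g =
  trans (cong (f zero + g zero +_) (Σᶠ-distrib-+ n (λ i → f (suc i)) (λ i → g (suc i))))
        (interchange (f zero) (g zero) _ _)

Σᶠ-comm : ∀ n m (f : Fin n → Fin m → ℕ) →
  Σᶠ n (λ i → Σᶠ m (f i)) ≡ Σᶠ m (λ j → Σᶠ n (λ i → f i j))
Σᶠ-comm zero    m f = sym (Σᶠ-zero m (λ _ → refl))
Σᶠ-comm (suc n) m f =
  trans (cong (Σᶠ m (f zero) +_) (Σᶠ-comm n m (λ i → f (suc i))))
        (sym (Σᶠ-distrib-+ m (f zero) (λ j → Σᶠ n (λ i → f (suc i) j))))

Σᶠ-≤-atMostOneNonzero : ∀ n (f : Fin n → ℕ) c → (∀ i → f i ≤ c) →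
  (∀ i j → f i ≢ 0 → f j ≢ 0 → i ≡ j) → Σᶠ n f ≤ c
Σᶠ-≤-atMostOneNonzero zero    f c f≤c unique = z≤n
Σᶠ-≤-atMostOneNonzero (suc n) f c f≤c unique with f zero ≟ℕ 0
... | yes f₀≡0 rewrite f₀≡0 =
  Σᶠ-≤-atMostOneNonzero n (λ i → f (suc i)) c (λ i → f≤c (suc i))
    (λ i j fᵢ≢0 fⱼ≢0 → suc-injective (unique (suc i) (suc j) fᵢ≢0 fⱼ≢0))
... | no f₀≢0 = subst (_≤ c) (sym sum≡f₀) (f≤c zero)
  where
  rest≡0 : ∀ i → f (suc i) ≡ 0
  rest≡0 i with f (suc i) ≟ℕ 0
  ... | yes fᵢ≡0 = fᵢ≡0
  ... | no fᵢ≢0 with () ← unique zero (suc i) f₀≢0 fᵢ≢0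

  sum≡f₀ : Σᶠ (suc n) f ≡ f zero
  sum≡f₀ = trans (cong (f zero +_) (Σᶠ-zero n rest≡0)) (+-identityʳ (f zero))

δ : ∀ {n} → Fin n → ℕ → Fin n → ℕ
δ k c z = if does (z ≟ k) then c else 0

δ-off : ∀ {n} (k : Fin n) c {z} → z ≢ k → δ k c z ≡ 0
δ-off k c {z} z≢k with z ≟ k
... | yes z≡k = ⊥-elim (z≢k z≡k)
... | no _    = refl

Σᶠ-δ : ∀ n (k : Fin n) c → Σᶠ n (δ k c) ≡ c
Σᶠ-δ (suc n) zero    c = trans (cong (c +_) (Σᶠ-zero n (λ _ → refl))) (+-identityʳ c)
Σᶠ-δ (suc n) (suc k) c = Σᶠ-δ n k c

Σᶠ-transfer-≤ : ∀ n (f g : Fin n → ℕ) x u c →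
  (∀ z → f z + δ x c z ≤ g z + δ u c z) → Σᶠ n f ≤ Σᶠ n g
Σᶠ-transfer-≤ n f g x u c pointwise = +-cancelʳ-≤ c (Σᶠ n f) (Σᶠ n g) (begin
  Σᶠ n f + c                       ≡⟨ cong (Σᶠ n f +_) (Σᶠ-δ n x c) ⟨
  Σᶠ n f + Σᶠ n (δ x c)            ≡⟨ Σᶠ-distrib-+ n f (δ x c) ⟨
  Σᶠ n (λ z → f z + δ x c z)       ≤⟨ Σᶠ-mono-≤ n pointwise ⟩
  Σᶠ n (λ z → g z + δ u c z)       ≡⟨ Σᶠ-distrib-+ n g (δ u c) ⟩
  Σᶠ n g + Σᶠ n (δ u c)            ≡⟨ cong (Σᶠ n g +_) (Σᶠ-δ n u c) ⟩
  Σᶠ n g + c                       ∎)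
  where open ≤-Reasoning

adjacent⇒≢ : ∀ {n} {E : Graph n} → (∀ a → E a a ≢ true) → ∀ {a b} → E a b ≡ true → b ≢ a
adjacent⇒≢ irrefl {a} ab refl = irrefl a ab

module _ {n : ℕ} {E : Graph n} {P : Fin n → Set} where

  _++ᵂ_ : ∀ {a b c} → Walk E P a b → Walk E P b c → Walk E P a c
  here            ++ᵂ q = q
  there e pb walk ++ᵂ q = there e pb (walk ++ᵂ q)

  reverseᵂ : (∀ a b → E a b ≡ true → E b a ≡ true) →
    ∀ {a b} → P a → Walk E P a b → Walk E P b a
  reverseᵂ sym-E pa here = here
  reverseᵂ sym-E pa (there {a} {b} e pb walk) =
    reverseᵂ sym-E pb walk ++ᵂ there (sym-E a b e) pa here

  targetᵂ : ∀ {a b} → P a → Walk E P a b → P b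
  targetᵂ pa here             = pa
  targetᵂ pa (there _ pb walk) = targetᵂ pb walk

record SimplePathAvoiding {n} (E : Graph n) (v a b : Fin n) : Set where
  field
    rest   : List (Fin n)
    unique : Unique (a ∷ rest)
    linked : Linked (Adj E) (a ∷ rest)
    ends   : last a rest ≡ b
    avoids : All (v ≢_) (a ∷ rest)

module _ {n : ℕ} {E : Graph n} {v : Fin n} where
  open SimplePathAvoiding
  open import Data.List.Membership.DecPropositional (_≟_ {n}) using (_∈?_)

  shortcut : ∀ {a b c} (p : SimplePathAvoiding E v a b) → c ∈ a ∷ rest p →
    SimplePathAvoiding E v c b
  shortcut p (here refl) = p
  shortcut record { rest = _ ∷ rest ; unique = _ ∷ unique ; linked = _ ∷ linked
                  ; ends = ends ; avoids = _ ∷ avoids } (there c∈rest) =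
    shortcut record { rest = rest ; unique = unique ; linked = linked
                    ; ends = ends ; avoids = avoids } c∈rest

  -- If a already lies on the simple path from b, that path is cut at a.
  walk⇒simplePath : ∀ {P : Fin n → Set} → (∀ y → P y → y ≢ v) →
    ∀ {a b} → a ≢ v → Walk E P a b → SimplePathAvoiding E v a b
  walk⇒simplePath P⇒≢v a≢v here = record
    { rest = [] ; unique = [] ∷ [] ; linked = [-] ; ends = refl ; avoids = ≢-sym a≢v ∷ [] }
  walk⇒simplePath P⇒≢v {a} a≢v (there {b = b} e pb walk)
    with p ← walk⇒simplePath P⇒≢v (P⇒≢v b pb) walk
       | a ∈? (b ∷ rest p)
  ... | yes a∈p = shortcut p a∈p
  ... | no  a∉p = record
    { rest = b ∷ rest p ; unique = ¬Any⇒All¬ (b ∷ rest p) a∉p ∷ unique p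
    ; linked = e ∷ linked p ; ends = ends p ; avoids = ≢-sym a≢v ∷ avoids p }

  -- Two distinct such neighbours would close a cycle through v.
  forest-neighbours-joined⇒≡ : ∀ {P : Fin n → Set} → Forest E →
    (∀ a b → E a b ≡ true → E b a ≡ true) → (∀ a → E a a ≢ true) →
    (∀ y → P y → y ≢ v) → ∀ {u₁ u₂} → E v u₁ ≡ true → E v u₂ ≡ true →
    Walk E P u₁ u₂ → u₁ ≡ u₂
  forest-neighbours-joined⇒≡ forest sym-E irrefl P⇒≢v {u₁} {u₂} vu₁ vu₂ walk
    with u₁ ≟ u₂
  ... | yes u₁≡u₂ = u₁≡u₂
  ... | no u₁≢u₂ with walk⇒simplePath P⇒≢v (adjacent⇒≢ irrefl vu₁) walk
  ...   | record { rest = [] ; ends = u₁≡u₂ } = ⊥-elim (u₁≢u₂ u₁≡u₂)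
  ...   | record { rest = c ∷ rest ; unique = unique ; linked = linked
                 ; ends = ends ; avoids = avoids } = ⊥-elim (forest
    (v , u₁ , c , rest , avoids ∷ unique , vu₁ ∷ linked ,
     subst (λ y → E y v ≡ true) (sym ends) (sym-E v u₂ vu₂)))

aliveWeight : ∀ {n} → State n → Fin n → ℕ
aliveWeight s z = if alive s z then w s z else 0

aliveWeight-alive : ∀ {n} (s : State n) {z} → alive s z ≡ true → aliveWeight s z ≡ w s z
aliveWeight-alive s z-alive rewrite z-alive = refl

aliveWeight-dead : ∀ {n} (s : State n) {z} → alive s z ≢ true → aliveWeight s z ≡ 0
aliveWeight-dead s {z} z-dead with alive s z
... | true  = ⊥-elim (z-dead refl)
... | false = refl

aliveWeight-mono : ∀ {n} (s s' : State n) {z} → (alive s' z ≡ true → alive s z ≡ true) →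
  w s' z ≡ w s z → aliveWeight s' z ≤ aliveWeight s z
aliveWeight-mono s s' {z} survives w-same with alive s' z in z-alive'
... | false = z≤n
... | true rewrite survives refl = ≤-reflexive w-same

module AliveWeightStep {n} {s s' : State n} {x : Fin n} (x-alive : alive s x ≡ true)
  (alive' : ∀ y → (alive s' y ≡ true) ⇔ ((alive s y ≡ true) × y ≢ x)) where

  x-dead : alive s' x ≢ true
  x-dead x-alive' = proj₂ (to (alive' x) x-alive') refl

  survives : ∀ z → alive s' z ≡ true → alive s z ≡ true
  survives z z-alive' = proj₁ (to (alive' z) z-alive')

  without-transfer : (∀ y → y ≢ x → w s' y ≡ w s y) →
    Σᶠ n (aliveWeight s') ≤ Σᶠ n (aliveWeight s)
  without-transfer w-same = Σᶠ-mono-≤ n pointwise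
    where
    pointwise : ∀ z → aliveWeight s' z ≤ aliveWeight s z
    pointwise z with z ≟ x
    ... | yes refl rewrite aliveWeight-dead s' x-dead = z≤n
    ... | no z≢x = aliveWeight-mono s s' (survives z) (w-same z z≢x)

  with-transfer : ∀ {u} → (alive s u ≡ true) × u ≢ x → w s' u ≡ w s u + w s x →
    (∀ y → y ≢ u → y ≢ x → w s' y ≡ w s y) →
    Σᶠ n (aliveWeight s') ≤ Σᶠ n (aliveWeight s)
  with-transfer {u} (u-alive , u≢x) w-u w-same =
    Σᶠ-transfer-≤ n (aliveWeight s') (aliveWeight s) x u (w s x) pointwise
    where
    pointwise : ∀ z → aliveWeight s' z + δ x (w s x) z ≤ aliveWeight s z + δ u (w s x) z
    pointwise z with z ≟ x
    ... | yes refl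
      rewrite aliveWeight-dead s' x-dead | aliveWeight-alive s x-alive
            | δ-off u (w s x) (≢-sym u≢x) = ≤-reflexive (+-comm 0 (w s x))
    ... | no z≢x with z ≟ u
    ...   | yes refl
      rewrite aliveWeight-alive s' (from (alive' u) (u-alive , u≢x))
            | aliveWeight-alive s u-alive | w-u = ≤-reflexive (+-identityʳ _)
    ...   | no z≢u =
      +-monoˡ-≤ 0 (aliveWeight-mono s s' (survives z) (w-same z z≢u z≢x))

record Invariant {n} (s : State n) : Set where
  field
    G-irreflexive : ∀ a → G s a a ≢ true
    G-alive       : ∀ {a b} → G s a b ≡ true → (alive s a ≡ true) × (alive s b ≡ true)
    H⊆G           : ∀ {a b} → H s a b ≡ true → G s a b ≡ true
    H-symmetric   : ∀ a b → H s a b ≡ true → H s b a ≡ true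
    H-forest      : Forest (H s)
    aliveWeight≤n : Σᶠ n (aliveWeight s) ≤ n

invariant-initial : ∀ {n} (G₀ : Graph n) → Irreflexive G₀ → Invariant (initial G₀)
invariant-initial {n} G₀ irrefl = record
  { G-irreflexive = λ a G₀aa → false≢true (trans (sym (irrefl a)) G₀aa)
  ; G-alive       = λ _ → refl , refl
  ; H⊆G           = λ ()
  ; H-symmetric   = λ _ _ ()
  ; H-forest      = λ { (_ , _ , _ , _ , _ , () ∷ _ , _) }
  ; aliveWeight≤n = ≤-reflexive (Σᶠ-const-1 n)
  }
  where
  false≢true : false ≢ true
  false≢true ()

invariant-step : ∀ {n} {s s' : State n} → Invariant s → Step s s' → Invariant s'
invariant-step {n} {s} {s'} I
  (x , N , x-alive , alive' , N-symmetric , N⊆N[x] , G' , H' , forest' , weights') = record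
  { G-irreflexive = G-irreflexive'
  ; G-alive       = G-alive'
  ; H⊆G           = H⊆G'
  ; H-symmetric   = H-symmetric'
  ; H-forest      = forest'
  ; aliveWeight≤n = ≤-trans aliveWeight-step aliveWeight≤n
  }
  where
  open Invariant I
  open AliveWeightStep {s = s} {s'} x-alive alive'

  neighbour-of-x : ∀ {a} → G s x a ≡ true → (alive s a ≡ true) × a ≢ x
  neighbour-of-x xa = proj₂ (G-alive xa) , adjacent⇒≢ G-irreflexive xa

  G-irreflexive' : ∀ a → G s' a a ≢ true
  G-irreflexive' a aa with to (G' a a) aa
  ... | inj₁ (aa , _) = G-irreflexive a aa
  ... | inj₂ Naa      = proj₂ (proj₂ (N⊆N[x] a a Naa)) refl

  G-alive' : ∀ {a b} → G s' a b ≡ true → (alive s' a ≡ true) × (alive s' b ≡ true)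
  G-alive' {a} {b} ab with to (G' a b) ab
  ... | inj₁ (ab , a≢x , b≢x) =
    from (alive' a) (proj₁ (G-alive ab) , a≢x) , from (alive' b) (proj₂ (G-alive ab) , b≢x)
  ... | inj₂ Nab with N⊆N[x] a b Nab
  ... | xa , xb , _ = from (alive' a) (neighbour-of-x xa) , from (alive' b) (neighbour-of-x xb)

  H⊆G' : ∀ {a b} → H s' a b ≡ true → G s' a b ≡ true
  H⊆G' {a} {b} ab with to (H' a b) ab
  ... | inj₁ (ab , a≢x , b≢x) = from (G' a b) (inj₁ (H⊆G ab , a≢x , b≢x))
  ... | inj₂ Nab              = from (G' a b) (inj₂ Nab)

  H-symmetric' : ∀ a b → H s' a b ≡ true → H s' b a ≡ true
  H-symmetric' a b ab with to (H' a b) ab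
  ... | inj₁ (ab , a≢x , b≢x) = from (H' b a) (inj₁ (H-symmetric a b ab , b≢x , a≢x))
  ... | inj₂ Nab              = from (H' b a) (inj₂ (trans (sym (N-symmetric a b)) Nab))

  aliveWeight-step : Σᶠ n (aliveWeight s') ≤ Σᶠ n (aliveWeight s)
  aliveWeight-step = [ (λ (_ , xu , w-u , w-same) → with-transfer (neighbour-of-x (H⊆G xu)) w-u w-same)
                     , (λ (_ , w-same) → without-transfer w-same) ]′ weights'

invariant-reachable : ∀ {n} {G₀ : Graph n} {s} → Irreflexive G₀ → Reachable G₀ s → Invariant s
invariant-reachable {G₀ = G₀} irrefl = preserved (invariant-initial G₀ irrefl)
  where
  preserved : ∀ {s s'} → Invariant s → Star Step s s' → Invariant s'
  preserved I ε              = I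
  preserved I (step ◅ steps) = preserved (invariant-step I step) steps

module Branches {n} {s : State n} (I : Invariant s) {v : Fin n} (v-alive : alive s v ≡ true)
  (T : Fin n → Fin n → Bool) (T-spec : ∀ u z → (T u z ≡ true) ⇔ InT s u v z) where
  open Invariant I

  branchWeight : Fin n → ℕ
  branchWeight u = if H s v u then WT s (T u) else 0

  branch : Fin n → Fin n → ℕ
  branch u z = if H s v u then (if T u z then w s z else 0) else 0

  branchWeight≡Σᶠbranch : ∀ u → branchWeight u ≡ Σᶠ n (branch u)
  branchWeight≡Σᶠbranch u with H s v u
  ... | true  = refl
  ... | false = sym (Σᶠ-zero n (λ _ → refl))

  H-irreflexive : ∀ a → H s a a ≢ true
  H-irreflexive a aa = G-irreflexive a (H⊆G aa)

  neighbour-of-v : ∀ {u} → H s v u ≡ true → (alive s u ≡ true) × u ≢ v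
  neighbour-of-v vu = proj₂ (G-alive (H⊆G vu)) , adjacent⇒≢ H-irreflexive vu

  branch≢0 : ∀ {u z} → branch u z ≢ 0 → (H s v u ≡ true) × InT s u v z
  branch≢0 {u} {z} nonzero with H s v u | T u z in uz
  ... | true  | true  = refl , to (T-spec u z) uz
  ... | true  | false = ⊥-elim (nonzero refl)
  ... | false | _     = ⊥-elim (nonzero refl)

  branch-≤ : ∀ u z → branch u z ≤ aliveWeight s z
  branch-≤ u z with H s v u in vu | T u z in uz
  ... | true  | true
    rewrite aliveWeight-alive s (proj₁ (targetᵂ (neighbour-of-v vu) (to (T-spec u z) uz))) = ≤-refl
  ... | true  | false = z≤n
  ... | false | _     = z≤n

  branch-at-v : ∀ u → branch u v ≡ 0
  branch-at-v u with branch u v ≟ℕ 0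
  ... | yes branch≡0 = branch≡0
  ... | no nonzero with vu , u↝v ← branch≢0 nonzero =
    ⊥-elim (proj₂ (targetᵂ (neighbour-of-v vu) u↝v) refl)

  branch-disjoint : ∀ z i j → branch i z ≢ 0 → branch j z ≢ 0 → i ≡ j
  branch-disjoint z i j iz jz with vi , i↝z ← branch≢0 iz | vj , j↝z ← branch≢0 jz =
    forest-neighbours-joined⇒≡ H-forest H-symmetric H-irreflexive (λ _ → proj₂) vi vj
      (i↝z ++ᵂ reverseᵂ H-symmetric (neighbour-of-v vj) j↝z)

  Σᶠbranch+w≤aliveWeight : Σᶠ n branchWeight + w s v ≤ Σᶠ n (aliveWeight s)
  Σᶠbranch+w≤aliveWeight = begin
    Σᶠ n branchWeight + w s v                                   ≡⟨ cong₂ _+_ split (Σᶠ-δ n v (w s v)) ⟨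
    Σᶠ n (λ z → Σᶠ n (λ u → branch u z)) + Σᶠ n (δ v (w s v))   ≡⟨ Σᶠ-distrib-+ n _ _ ⟨
    Σᶠ n (λ z → Σᶠ n (λ u → branch u z) + δ v (w s v) z)        ≤⟨ Σᶠ-mono-≤ n column ⟩
    Σᶠ n (aliveWeight s)                                        ∎
    where
    open ≤-Reasoning
    split : Σᶠ n (λ z → Σᶠ n (λ u → branch u z)) ≡ Σᶠ n branchWeight
    split = sym (trans (Σᶠ-cong n branchWeight≡Σᶠbranch) (Σᶠ-comm n n branch))

    column : ∀ z → Σᶠ n (λ u → branch u z) + δ v (w s v) z ≤ aliveWeight s z
    column z with z ≟ v
    ... | yes refl rewrite Σᶠ-zero n branch-at-v | aliveWeight-alive s v-alive = ≤-refl
    ... | no z≢v rewrite +-identityʳ (Σᶠ n (λ u → branch u z)) =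
      Σᶠ-≤-atMostOneNonzero n (λ u → branch u z) (aliveWeight s z) (λ u → branch-≤ u z)
        (branch-disjoint z)

lemma2p5 : (n : ℕ) (G₀ : Graph n) → Symmetric G₀ → Irreflexive G₀ → Connected G₀ →
    (s : State n) → Reachable G₀ s →
    (v : Fin n) → alive s v ≡ true →
    (T : Fin n → Fin n → Bool) → (∀ u z → (T u z ≡ true) ⇔ InT s u v z) →
    rem s T v ≤ n
lemma2p5 n G₀ _ irrefl _ s reachable v v-alive T T-spec = begin
  rem s T v                   ≤⟨ +-monoˡ-≤ (w s v) (m∸n≤m _ (Maxᶠ n branchWeight)) ⟩
  Σᶠ n branchWeight + w s v   ≤⟨ Σᶠbranch+w≤aliveWeight ⟩
  Σᶠ n (aliveWeight s)        ≤⟨ aliveWeight≤n ⟩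
  n                           ∎
  where
  I : Invariant s
  I = invariant-reachable irrefl reachable
  open Invariant I using (aliveWeight≤n)
  open Branches I v-alive T T-spec
  open ≤-Reasoning
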